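{- Let $n\ge 2$ and consider, for unknowns $x=(x_0,\dots,x_{n-1})$, the system $$x_0=-\frac{1}{1+\sum_{k=1}^{n-1}\frac{x_k}{x_0}},\qquad \sum_{i=0}^{n-1}\frac{x_{i+j}}{x_i}=-1\quad (j=1,\dots,n-1),$$ and, for unknowns $z=(z_0,\dots,z_{n-1})$, the system $$\sum_{i=0}^{n-1}\prod_{l=0}^{k-1} z_{i+l}=-1\quad (k=1,\dots,n-1),\qquad z_0z_1\cdots z_{n-1}=1,$$ where all indices are taken modulo $n$. Then every solution $x$ of the first system with all $|x_i|=1$ gives, via $z_i=x_{i+1}/x_i$, a solution $z$ of the second system with all $|z_i|=1$; and conversely every solution $z$ of the second system with all $|z_i|=1$ arises in this way from a unimodular solution $x$ of the first system (namely $x=-\bar S\,(1,z_0,z_0z_1,\dots,z_0z_1\cdots z_{n-2})$ with $S=z_0+z_0z_1+\dots+z_0z_1\cdots z_{n-1}$).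
   Context: The unimodular solutions $x$ of the first system are exactly the first rows of circulant cores $\mathrm{Circ}(x)$ (entries $x_{j-i}$) for which the $(n+1)\times(n+1)$ matrix obtained by bordering $\mathrm{Circ}(x)$ with a row and column of $1$'s is a complex Hadamard matrix (unimodular entries, $HH^\ast=(n+1)I$). -}

module Defs where

open import Level using (Level; _⊔_)
open import Data.Nat using (ℕ; zero; suc; NonZero)
import Data.Nat
open import Data.Nat.DivMod using (_mod_)
open import Data.Fin using (Fin; toℕ)
open import Data.Product using (_×_)
open import Relation.Nullary using (¬_)
open import Algebra.Bundles using (CommutativeRing)

-- A field with an involutive conjugation (the abstract setting standing in
-- for the complex numbers ℂ with complex conjugation).
record FieldWithConj (c ℓ : Level) : Set (Level.suc (c ⊔ ℓ)) where
  field
    commRing : CommutativeRing c ℓ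
  open CommutativeRing commRing public
  field
    conj      : Carrier → Carrier
    conj-cong : ∀ {x y} → x ≈ y → conj x ≈ conj y
    conj-+    : ∀ x y → conj (x + y) ≈ conj x + conj y
    conj-*    : ∀ x y → conj (x * y) ≈ conj x * conj y
    conj-1    : conj 1# ≈ 1#
    conj-conj : ∀ x → conj (conj x) ≈ x
    inv       : Carrier → Carrier
    inv-cong  : ∀ {x y} → x ≈ y → inv x ≈ inv y
    inv-law   : ∀ x → ¬ (x ≈ 0#) → x * inv x ≈ 1#
    1≉0       : ¬ (1# ≈ 0#)

module Systems {c ℓ : Level} (F : FieldWithConj c ℓ) where
  open FieldWithConj F

  _/_ : Carrier → Carrier → Carrier
  a / b = a * inv b

  sumTo : ℕ → (ℕ → Carrier) → Carrier
  sumTo zero    f = 0#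
  sumTo (suc m) f = sumTo m f + f m

  prodTo : ℕ → (ℕ → Carrier) → Carrier
  prodTo zero    f = 1#
  prodTo (suc m) f = prodTo m f * f m

  Unimodular : Carrier → Set ℓ
  Unimodular a = a * conj a ≈ 1#

  AllUnimodular : {n : ℕ} → (Fin n → Carrier) → Set ℓ
  AllUnimodular {n} v = ∀ i → Unimodular (v i)

  at : {n : ℕ} .{{_ : NonZero n}} → (Fin n → Carrier) → ℕ → Carrier
  at {n} v i = v (i mod n)

  System1 : (n : ℕ) .{{_ : NonZero n}} → (Fin n → Carrier) → Set ℓ
  System1 n x =
    let D = 1# + sumTo n (λ k → if0 k (λ k' → at x (suc k') / at x 0)) in
      (¬ (D ≈ 0#) × at x 0 ≈ - (1# / D))
    × (∀ j → 1 Data.Nat.≤ j → j Data.Nat.< n →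
         sumTo n (λ i → at x (i Data.Nat.+ j) / at x i) ≈ - 1#)
    where
      -- term for k = 0 is dropped, so the sum runs over k = 1..n-1
      if0 : ℕ → (ℕ → Carrier) → Carrier
      if0 zero    g = 0#
      if0 (suc k) g = g k

  System2 : (n : ℕ) .{{_ : NonZero n}} → (Fin n → Carrier) → Set ℓ
  System2 n z =
      (∀ k → 1 Data.Nat.≤ k → k Data.Nat.< n →
         sumTo n (λ i → prodTo k (λ l → at z (i Data.Nat.+ l))) ≈ - 1#)
    × prodTo n (at z) ≈ 1#

  zOf : (n : ℕ) .{{_ : NonZero n}} → (Fin n → Carrier) → Fin n → Carrier
  zOf n x i = at x (suc (toℕ i)) / at x (toℕ i)

  S-of : (n : ℕ) .{{_ : NonZero n}} → (Fin n → Carrier) → Carrier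
  S-of n z = sumTo n (λ k → prodTo (suc k) (at z))

  xOf : (n : ℕ) .{{_ : NonZero n}} → (Fin n → Carrier) → Fin n → Carrier
  xOf n z i = - (conj (S-of n z)) * prodTo (toℕ i) (at z)

-- Write π_j = z₀ ⋯ z_{j-1}, indices mod n.  The relation z₀ ⋯ z_{n-1} = 1 makes π periodic with
-- z_j π_j = π_{j+1}, so the cyclic window products z_i ⋯ z_{i+k-1} are the ratios π_{i+k}/π_i,
-- just as for z_i = x_{i+1}/x_i they are x_{i+k}/x_i.  Hence the two systems say the same thing,
-- except for the first equation of the first, which holds for x = -S̄ π once |S| = 1, where
-- S = Σ_j π_{j+1} = Σ_j π_j.  Summing all n² window products by rows gives Σ_i Σ_d π_{i+d} π̄_i = S S̄;
-- summing them by window length gives n − (n − 1) = 1.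

module Submission where

open import Defs
open import Level using (Level)
open import Data.Nat as ℕ using (ℕ; NonZero; _≤_; zero; suc; _<_; _%_; s≤s; z≤n)
open import Data.Nat.Properties as ℕₚ using (+-suc; n<1+n; <⇒≤; m<n⇒m<1+n; m≤n⇒m<n∨m≡n)
open import Data.Nat.DivMod using (_mod_; m%n<n; m%n%n≡m%n; [m+n]%n≡m%n; n%n≡0; m<n⇒m%n≡m; %-distribˡ-+)
open import Data.Fin using (Fin; toℕ)
open import Data.Fin.Properties using (toℕ-fromℕ<; toℕ-injective; toℕ<n)
open import Data.Product using (_×_; _,_; proj₁; proj₂)
open import Data.Sum using (inj₁; inj₂)
open import Function using (_∘_)
open import Relation.Nullary using (¬_)
open import Relation.Binary.PropositionalEquality as ≡ using (_≡_)
import Algebra.Properties.Ring as RingProperties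
import Algebra.Properties.CommutativeSemigroup as CommutativeSemigroupProperties

module Modular (n : ℕ) .{{_ : NonZero n}} where

  toℕ-mod : ∀ a → toℕ (a mod n) ≡ a % n
  toℕ-mod a = toℕ-fromℕ< (m%n<n a n)

  mod-cong : ∀ {a b} → a % n ≡ b % n → a mod n ≡ b mod n
  mod-cong {a} {b} e = toℕ-injective (≡.trans (toℕ-mod a) (≡.trans e (≡.sym (toℕ-mod b))))

  toℕ-mod-% : ∀ a → toℕ (a mod n) % n ≡ a % n
  toℕ-mod-% a = ≡.trans (≡.cong (_% n) (toℕ-mod a)) (m%n%n≡m%n a n)

  suc-% : ∀ a → suc a % n ≡ suc (a % n) % n
  suc-% a = ≡.trans (%-distribˡ-+ 1 a n)
    (≡.trans (≡.cong (λ t → (1 % n ℕ.+ t) % n) (≡.sym (m%n%n≡m%n a n)))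
      (≡.sym (%-distribˡ-+ 1 (a % n) n)))

  toℕ-% : (i : Fin n) → toℕ i % n ≡ toℕ i
  toℕ-% i = m<n⇒m%n≡m (toℕ<n i)

module Properties {c ℓ : Level} (F : FieldWithConj c ℓ) where
  open FieldWithConj F
  open Systems F
  open RingProperties ring
    using (-‿distribˡ-*; -‿distribʳ-*; -‿involutive; +-inverseʳ-unique; +-cancelˡ; x+x≈x⇒x≈0)
  open CommutativeSemigroupProperties *-commutativeSemigroup using (interchange; xy∙z≈y∙xz)
  open CommutativeSemigroupProperties +-commutativeSemigroup using () renaming (interchange to +-interchange)
  open import Relation.Binary.Reasoning.Setoid setoid

  -x*-y≈x*y : ∀ a b → (- a) * (- b) ≈ a * b
  -x*-y≈x*y a b = begin
    (- a) * (- b)   ≈⟨ -‿distribˡ-* a (- b) ⟨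
    - (a * (- b))   ≈⟨ -‿cong (-‿distribʳ-* a b) ⟨
    - (- (a * b))   ≈⟨ -‿involutive (a * b) ⟩
    a * b           ∎

  *≈⇒≈/ : ∀ {a b d} → ¬ (d ≈ 0#) → a * d ≈ b → a ≈ b / d
  *≈⇒≈/ {a} {b} {d} d≉0 ad≈b = begin
    a               ≈⟨ *-identityʳ a ⟨
    a * 1#          ≈⟨ *-congˡ (inv-law d d≉0) ⟨
    a * (d * inv d) ≈⟨ *-assoc a d (inv d) ⟨
    (a * d) * inv d ≈⟨ *-congʳ ad≈b ⟩
    b / d           ∎

  /*-cancel : ∀ {d} → ¬ (d ≈ 0#) → ∀ a → (a / d) * d ≈ a
  /*-cancel {d} d≉0 a = begin
    (a * inv d) * d ≈⟨ *-assoc a (inv d) d ⟩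
    a * (inv d * d) ≈⟨ *-congˡ (*-comm (inv d) d) ⟩
    a * (d * inv d) ≈⟨ *-congˡ (inv-law d d≉0) ⟩
    a * 1#          ≈⟨ *-identityʳ a ⟩
    a               ∎

  conj-0 : conj 0# ≈ 0#
  conj-0 = x+x≈x⇒x≈0 (conj 0#) (trans (sym (conj-+ 0# 0#)) (conj-cong (+-identityʳ 0#)))

  conj-neg : ∀ a → conj (- a) ≈ - conj a
  conj-neg a = +-inverseʳ-unique (conj a) (conj (- a))
    (trans (sym (conj-+ a (- a))) (trans (conj-cong (-‿inverseʳ a)) conj-0))

  unimodular⇒≉0 : ∀ {a} → Unimodular a → ¬ (a ≈ 0#)
  unimodular⇒≉0 {a} u a≈0 = 1≉0 (begin
    1#          ≈⟨ u ⟨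
    a * conj a  ≈⟨ *-congʳ a≈0 ⟩
    0# * conj a ≈⟨ zeroˡ (conj a) ⟩
    0#          ∎)

  inv≈conj : ∀ {a} → Unimodular a → inv a ≈ conj a
  inv≈conj u = sym (trans (*≈⇒≈/ (unimodular⇒≉0 u) (trans (*-comm _ _) u)) (*-identityˡ _))

  unimodular-resp-≈ : ∀ {a b} → a ≈ b → Unimodular a → Unimodular b
  unimodular-resp-≈ a≈b u = trans (sym (*-cong a≈b (conj-cong a≈b))) u

  unimodular-1 : Unimodular 1#
  unimodular-1 = trans (*-congˡ conj-1) (*-identityˡ 1#)

  unimodular-* : ∀ {a b} → Unimodular a → Unimodular b → Unimodular (a * b)
  unimodular-* {a} {b} ua ub = begin
    (a * b) * conj (a * b)      ≈⟨ *-congˡ (conj-* a b) ⟩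
    (a * b) * (conj a * conj b) ≈⟨ interchange a b (conj a) (conj b) ⟩
    (a * conj a) * (b * conj b) ≈⟨ *-cong ua ub ⟩
    1# * 1#                     ≈⟨ *-identityˡ 1# ⟩
    1#                          ∎

  unimodular-conj : ∀ {a} → Unimodular a → Unimodular (conj a)
  unimodular-conj {a} u = trans (*-congˡ (conj-conj a)) (trans (*-comm _ _) u)

  unimodular-/ : ∀ {a b} → Unimodular a → Unimodular b → Unimodular (a / b)
  unimodular-/ ua ub = unimodular-* ua (unimodular-resp-≈ (sym (inv≈conj ub)) (unimodular-conj ub))

  unimodular-neg : ∀ {a} → Unimodular a → Unimodular (- a)
  unimodular-neg {a} u = trans (*-congˡ (conj-neg a)) (trans (-x*-y≈x*y a (conj a)) u)

  unimodular-prodTo : ∀ {f} → (∀ i → Unimodular (f i)) → ∀ m → Unimodular (prodTo m f)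
  unimodular-prodTo u zero    = unimodular-1
  unimodular-prodTo u (suc m) = unimodular-* (unimodular-prodTo u m) (u m)

  sumTo-cong : ∀ m {f g : ℕ → Carrier} → (∀ i → i < m → f i ≈ g i) → sumTo m f ≈ sumTo m g
  sumTo-cong zero    f≈g = refl
  sumTo-cong (suc m) f≈g = +-cong (sumTo-cong m (λ i i<m → f≈g i (m<n⇒m<1+n i<m))) (f≈g m (n<1+n m))

  sumTo-suc : ∀ m (f : ℕ → Carrier) → sumTo (suc m) f ≈ f 0 + sumTo m (f ∘ suc)
  sumTo-suc zero    f = trans (+-identityˡ (f 0)) (sym (+-identityʳ (f 0)))
  sumTo-suc (suc m) f = trans (+-congʳ (sumTo-suc m f)) (+-assoc _ _ _)

  sumTo-+ : ∀ m (f g : ℕ → Carrier) → sumTo m (λ i → f i + g i) ≈ sumTo m f + sumTo m g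
  sumTo-+ zero    f g = sym (+-identityʳ 0#)
  sumTo-+ (suc m) f g = trans (+-congʳ (sumTo-+ m f g)) (+-interchange _ _ _ _)

  sumTo-0# : ∀ m → sumTo m (λ _ → 0#) ≈ 0#
  sumTo-0# zero    = refl
  sumTo-0# (suc m) = trans (+-identityʳ _) (sumTo-0# m)

  sumTo-comm : ∀ m k (f : ℕ → ℕ → Carrier) →
    sumTo m (λ i → sumTo k (f i)) ≈ sumTo k (λ d → sumTo m (λ i → f i d))
  sumTo-comm zero    k f = sym (sumTo-0# k)
  sumTo-comm (suc m) k f = trans (+-congʳ (sumTo-comm m k f))
    (sym (sumTo-+ k (λ d → sumTo m (λ i → f i d)) (f m)))

  *-distribˡ-sumTo : ∀ m a (f : ℕ → Carrier) → a * sumTo m f ≈ sumTo m (λ i → a * f i)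
  *-distribˡ-sumTo zero    a f = zeroʳ a
  *-distribˡ-sumTo (suc m) a f = trans (distribˡ a _ _) (+-congʳ (*-distribˡ-sumTo m a f))

  *-distribʳ-sumTo : ∀ m a (f : ℕ → Carrier) → sumTo m f * a ≈ sumTo m (λ i → f i * a)
  *-distribʳ-sumTo m a f = trans (*-comm _ a)
    (trans (*-distribˡ-sumTo m a f) (sumTo-cong m (λ i _ → *-comm a (f i))))

  conj-sumTo : ∀ m (f : ℕ → Carrier) → conj (sumTo m f) ≈ sumTo m (conj ∘ f)
  conj-sumTo zero    f = conj-0
  conj-sumTo (suc m) f = trans (conj-+ _ _) (+-congʳ (conj-sumTo m f))

  sumTo-1#+sumTo-‿1# : ∀ m → sumTo (suc m) (λ _ → 1#) + sumTo m (λ _ → - 1#) ≈ 1#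
  sumTo-1#+sumTo-‿1# zero    = trans (+-identityʳ _) (+-identityˡ 1#)
  sumTo-1#+sumTo-‿1# (suc m) = begin
    (sumTo (suc m) (λ _ → 1#) + 1#) + (sumTo m (λ _ → - 1#) + - 1#)
      ≈⟨ +-interchange _ 1# _ (- 1#) ⟩
    (sumTo (suc m) (λ _ → 1#) + sumTo m (λ _ → - 1#)) + (1# - 1#)
      ≈⟨ +-cong (sumTo-1#+sumTo-‿1# m) (-‿inverseʳ 1#) ⟩
    1# + 0#
      ≈⟨ +-identityʳ 1# ⟩
    1# ∎

  -- Moving the window from i to i + 1 trades g i for g (i + m), and these agree.
  sumTo-periodic : ∀ m (g : ℕ → Carrier) → (∀ i → g (i ℕ.+ m) ≈ g i) →
    ∀ i → sumTo m (λ d → g (i ℕ.+ d)) ≈ sumTo m g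
  sumTo-periodic m g periodic zero    = refl
  sumTo-periodic m g periodic (suc i) =
    trans (+-cancelˡ (h 0) _ _ (begin
      h 0 + sumTo m (λ d → g (suc i ℕ.+ d))
        ≈⟨ +-congˡ (sumTo-cong m (λ d _ → reflexive (≡.cong g (≡.sym (+-suc i d))))) ⟩
      h 0 + sumTo m (h ∘ suc)
        ≈⟨ sumTo-suc m h ⟨
      sumTo m h + h m
        ≈⟨ +-congˡ (trans (periodic i) (reflexive (≡.cong g (≡.sym (ℕₚ.+-identityʳ i))))) ⟩
      sumTo m h + h 0
        ≈⟨ +-comm _ _ ⟩
      h 0 + sumTo m h ∎))
      (sumTo-periodic m g periodic i)
    where
      h : ℕ → Carrier
      h d = g (i ℕ.+ d)

  prodTo-telescope : (w g : ℕ → Carrier) → (∀ j → w j * g j ≈ g (suc j)) →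
    ∀ i k → prodTo k (λ l → w (i ℕ.+ l)) * g i ≈ g (i ℕ.+ k)
  prodTo-telescope w g step i zero    =
    trans (*-identityˡ (g i)) (reflexive (≡.cong g (≡.sym (ℕₚ.+-identityʳ i))))
  prodTo-telescope w g step i (suc k) = begin
    (prodTo k (λ l → w (i ℕ.+ l)) * w (i ℕ.+ k)) * g i ≈⟨ xy∙z≈y∙xz _ _ _ ⟩
    w (i ℕ.+ k) * (prodTo k (λ l → w (i ℕ.+ l)) * g i) ≈⟨ *-congˡ (prodTo-telescope w g step i k) ⟩
    w (i ℕ.+ k) * g (i ℕ.+ k)                          ≈⟨ step (i ℕ.+ k) ⟩
    g (suc (i ℕ.+ k))                                  ≈⟨ reflexive (≡.cong g (≡.sym (+-suc i k))) ⟩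
    g (i ℕ.+ suc k)                                    ∎

  prodTo-window : (w g : ℕ → Carrier) → (∀ j → Unimodular (g j)) → (∀ j → w j * g j ≈ g (suc j)) →
    ∀ i k → prodTo k (λ l → w (i ℕ.+ l)) ≈ g (i ℕ.+ k) / g i
  prodTo-window w g ug step i k = *≈⇒≈/ (unimodular⇒≉0 (ug i)) (prodTo-telescope w g step i k)

  module _ {n : ℕ} .{{_ : NonZero n}} (v : Fin n → Carrier) where
    open Modular n

    at-cong : ∀ {a b} → a % n ≡ b % n → at v a ≈ at v b
    at-cong e = reflexive (≡.cong v (mod-cong e))

    at-toℕ : (i : Fin n) → at v (toℕ i) ≈ v i
    at-toℕ i = reflexive (≡.cong v (toℕ-injective (≡.trans (toℕ-mod (toℕ i)) (toℕ-% i))))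

    at-periodic : ∀ a → at v (a ℕ.+ n) ≈ at v a
    at-periodic a = at-cong ([m+n]%n≡m%n a n)

    at-unimodular : AllUnimodular v → ∀ a → Unimodular (at v a)
    at-unimodular u a = u (a mod n)

module Forward {c ℓ : Level} (F : FieldWithConj c ℓ) (n : ℕ) .{{_ : NonZero n}}
               (x : Fin n → FieldWithConj.Carrier F) (ux : Systems.AllUnimodular F x) where
  open FieldWithConj F
  open Systems F
  open Properties F
  open Modular n

  z : Fin n → Carrier
  z = zOf n x

  at-zOf : ∀ j → at z j ≈ at x (suc j) / at x j
  at-zOf j = *-cong
    (at-cong x (≡.trans (≡.cong (λ t → suc t % n) (toℕ-mod j)) (≡.sym (suc-% j))))
    (inv-cong (at-cong x (toℕ-mod-% j)))

  z-step : ∀ j → at z j * at x j ≈ at x (suc j)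
  z-step j = trans (*-congʳ (at-zOf j)) (/*-cancel (unimodular⇒≉0 (at-unimodular x ux j)) _)

  window : ∀ i k → prodTo k (λ l → at z (i ℕ.+ l)) ≈ at x (i ℕ.+ k) / at x i
  window = prodTo-window (at z) (at x) (at-unimodular x ux) z-step

  solves : System1 n x → AllUnimodular z × System2 n z
  solves (_ , ratio-sums) =
      (λ i → unimodular-/ (ux _) (ux _))
    , (λ k 1≤k k<n → trans (sumTo-cong n (λ i _ → window i k)) (ratio-sums k 1≤k k<n))
    , (begin
        prodTo n (at z)   ≈⟨ window 0 n ⟩
        at x n / at x 0   ≈⟨ *-congʳ (at-periodic x 0) ⟩
        at x 0 / at x 0   ≈⟨ inv-law (at x 0) (unimodular⇒≉0 (at-unimodular x ux 0)) ⟩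
        1#                ∎)
    where open import Relation.Binary.Reasoning.Setoid setoid

module Converse {c ℓ : Level} (F : FieldWithConj c ℓ) (m : ℕ)
                (z : Fin (suc m) → FieldWithConj.Carrier F) (uz : Systems.AllUnimodular F z)
                (s2 : Systems.System2 F (suc m) z) where
  open FieldWithConj F
  open Systems F
  open Properties F
  open CommutativeSemigroupProperties *-commutativeSemigroup using (x∙yz≈y∙xz)
  open import Relation.Binary.Reasoning.Setoid setoid

  n : ℕ
  n = suc m

  open Modular n

  window-sums : ∀ k → 1 ≤ k → k < n → sumTo n (λ i → prodTo k (λ l → at z (i ℕ.+ l))) ≈ - 1#
  window-sums = proj₁ s2

  -- xOf n z i is definitionally - conj S * π i.
  π : Fin n → Carrier
  π i = prodTo (toℕ i) (at z)

  prodTo-% : ∀ r → r ≤ n → prodTo (r % n) (at z) ≈ prodTo r (at z)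
  prodTo-% r r≤n with m≤n⇒m<n∨m≡n r≤n
  ... | inj₁ r<n    = reflexive (≡.cong (λ t → prodTo t (at z)) (m<n⇒m%n≡m r<n))
  ... | inj₂ ≡.refl = trans (reflexive (≡.cong (λ t → prodTo t (at z)) (n%n≡0 n))) (sym (proj₂ s2))

  at-π : ∀ j → at π j ≈ prodTo (j % n) (at z)
  at-π j = reflexive (≡.cong (λ t → prodTo t (at z)) (toℕ-mod j))

  π-step : ∀ j → at z j * at π j ≈ at π (suc j)
  π-step j = begin
    at z j * at π j                      ≈⟨ *-cong (at-cong z {j % n} {j} (m%n%n≡m%n j n)) (sym (at-π j)) ⟨
    at z (j % n) * prodTo (j % n) (at z) ≈⟨ *-comm _ _ ⟩
    prodTo (suc (j % n)) (at z)          ≈⟨ prodTo-% (suc (j % n)) (m%n<n j n) ⟨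
    prodTo (suc (j % n) % n) (at z)      ≈⟨ reflexive (≡.cong (λ t → prodTo t (at z)) (suc-% j)) ⟨
    prodTo (suc j % n) (at z)            ≈⟨ at-π (suc j) ⟨
    at π (suc j)                         ∎

  π-unimodular : AllUnimodular π
  π-unimodular i = unimodular-prodTo (at-unimodular z uz) (toℕ i)

  window : ∀ i d → prodTo d (λ l → at z (i ℕ.+ l)) ≈ at π (i ℕ.+ d) * conj (at π i)
  window i d = trans (prodTo-window (at z) (at π) (at-unimodular π π-unimodular) π-step i d)
                     (*-congˡ (inv≈conj (at-unimodular π π-unimodular i)))

  G : Carrier
  G = sumTo n (at π)

  window-total : Carrier
  window-total = sumTo n (λ i → sumTo n (λ d → prodTo d (λ l → at z (i ℕ.+ l))))

  window-total-by-rows : window-total ≈ G * conj G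
  window-total-by-rows = begin
    window-total
      ≈⟨ sumTo-cong n (λ i _ → sumTo-cong n (λ d _ → window i d)) ⟩
    sumTo n (λ i → sumTo n (λ d → at π (i ℕ.+ d) * conj (at π i)))
      ≈⟨ sumTo-cong n (λ i _ → *-distribʳ-sumTo n (conj (at π i)) (λ d → at π (i ℕ.+ d))) ⟨
    sumTo n (λ i → sumTo n (λ d → at π (i ℕ.+ d)) * conj (at π i))
      ≈⟨ sumTo-cong n (λ i _ → *-congʳ (sumTo-periodic n (at π) (at-periodic π) i)) ⟩
    sumTo n (λ i → G * conj (at π i))
      ≈⟨ *-distribˡ-sumTo n G (conj ∘ at π) ⟨
    G * sumTo n (conj ∘ at π)
      ≈⟨ *-congˡ (conj-sumTo n (at π)) ⟨
    G * conj G ∎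

  window-total-by-length : window-total ≈ 1#
  window-total-by-length = begin
    window-total
      ≈⟨ sumTo-comm n n (λ i d → prodTo d (λ l → at z (i ℕ.+ l))) ⟩
    sumTo n (λ d → sumTo n (λ i → prodTo d (λ l → at z (i ℕ.+ l))))
      ≈⟨ sumTo-suc m _ ⟩
    sumTo n (λ _ → 1#) + sumTo m (λ d → sumTo n (λ i → prodTo (suc d) (λ l → at z (i ℕ.+ l))))
      ≈⟨ +-congˡ (sumTo-cong m (λ d d<m → window-sums (suc d) (s≤s z≤n) (s≤s d<m))) ⟩
    sumTo n (λ _ → 1#) + sumTo m (λ _ → - 1#)
      ≈⟨ sumTo-1#+sumTo-‿1# m ⟩
    1# ∎

  S : Carrier
  S = S-of n z

  S≈G : S ≈ G
  S≈G = trans (sumTo-cong n prefix≈π) (sumTo-periodic n (at π) (at-periodic π) 1)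
    where
      prefix≈π : ∀ k → k < n → prodTo (suc k) (at z) ≈ at π (suc k)
      prefix≈π k k<n = begin
        prodTo k (at z) * at z k ≈⟨ *-comm _ _ ⟩
        at z k * prodTo k (at z) ≈⟨ *-congˡ (trans (at-π k) (prodTo-% k (<⇒≤ k<n))) ⟨
        at z k * at π k          ≈⟨ π-step k ⟩
        at π (suc k)             ∎

  S-unimodular : Unimodular S
  S-unimodular = unimodular-resp-≈ (sym S≈G) (trans (sym window-total-by-rows) window-total-by-length)

  x : Fin n → Carrier
  x = xOf n z

  x-unimodular : AllUnimodular x
  x-unimodular i = unimodular-* (unimodular-neg (unimodular-conj S-unimodular)) (π-unimodular i)

  x-step : ∀ j → at z j * at x j ≈ at x (suc j)
  x-step j = trans (x∙yz≈y∙xz _ _ _) (*-congˡ (π-step j))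

  -- f abstracts the summand of the first equation of System1, whose local helper is not nameable here.
  first-equation : (f : ℕ → Carrier) → f 0 ≈ 0# → (∀ k → f (suc k) ≈ at x (suc k) / at x 0) →
    ¬ (1# + sumTo n f ≈ 0#) × at x 0 ≈ - (1# / (1# + sumTo n f))
  first-equation f f0≈0 fsuc = D≉0 , x0≈
    where
      ratio≈π : ∀ k → at x (suc k) / at x 0 ≈ at π (suc k)
      ratio≈π k = sym (*≈⇒≈/ (unimodular⇒≉0 (at-unimodular x x-unimodular 0))
        (trans (*-congˡ (*-identityʳ _)) (*-comm _ _)))
      D≈S : 1# + sumTo n f ≈ S
      D≈S = begin
        1# + sumTo n f                   ≈⟨ +-congˡ (sumTo-suc m f) ⟩
        1# + (f 0 + sumTo m (f ∘ suc))   ≈⟨ +-congˡ (+-cong f0≈0 (sumTo-cong m (λ k _ → trans (fsuc k) (ratio≈π k)))) ⟩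
        1# + (0# + sumTo m (at π ∘ suc)) ≈⟨ +-congˡ (+-identityˡ _) ⟩
        at π 0 + sumTo m (at π ∘ suc)    ≈⟨ sumTo-suc m (at π) ⟨
        G                                ≈⟨ S≈G ⟨
        S                                ∎
      D≉0 : ¬ (1# + sumTo n f ≈ 0#)
      D≉0 D≈0 = unimodular⇒≉0 S-unimodular (trans (sym D≈S) D≈0)
      x0≈ : at x 0 ≈ - (1# / (1# + sumTo n f))
      x0≈ = trans (*-identityʳ _)
        (-‿cong (*≈⇒≈/ D≉0 (trans (*-congˡ D≈S) (trans (*-comm _ _) S-unimodular))))

  solves : AllUnimodular x × System1 n x × (∀ i → z i ≈ zOf n x i)
  solves =
      x-unimodular
    , ( first-equation _ refl (λ _ → refl)
      , λ j 1≤j j<n → trans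
          (sumTo-cong n (λ i _ → sym (prodTo-window (at z) (at x) (at-unimodular x x-unimodular) x-step i j)))
          (window-sums j 1≤j j<n))
    , λ i → trans (sym (at-toℕ z i))
        (*≈⇒≈/ (unimodular⇒≉0 (at-unimodular x x-unimodular (toℕ i))) (x-step (toℕ i)))

theoremC1p2 : {c ℓ : Level} (F : FieldWithConj c ℓ) → let open FieldWithConj F in let open Systems F in
    (n : ℕ) .{{_ : NonZero n}} → 2 ≤ n →
      ((x : Fin n → Carrier) → AllUnimodular x → System1 n x →
          AllUnimodular (zOf n x) × System2 n (zOf n x))
    × ((z : Fin n → Carrier) → AllUnimodular z → System2 n z →
          AllUnimodular (xOf n z) × System1 n (xOf n z)
            × (∀ i → z i ≈ zOf n (xOf n z) i))
theoremC1p2 F (suc m) _ = (λ x ux → Forward.solves F (suc m) x ux) , (λ z uz s2 → Converse.solves F m z uz s2)
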